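{- Let $n\ge 1$ and let $a_0,a_1,\dots,a_n$ be positive integers. If $a_0$ or $a_1$ is even, then the Node-Kayles Grundy value $\mathcal{G}\left(T_{\{a_0,\dots,a_n\}}\right)$ is positive.
   Context: For a sequence of positive integers $a_0,\dots,a_n$, $T_{\{a_0,\dots,a_n\}}$ denotes the rooted tree of depth $n+1$ in which the root (level $0$) has $a_0$ children and every vertex at level $i$ has exactly $a_i$ children for $i=0,\dots,n$ (vertices at level $n+1$ are leaves). Node-Kayles is the impartial game on a finite simple graph $G$ in which a move chooses a vertex $v$ and deletes its closed neighbourhood $N_G[v]$; the Grundy value is defined by $\mathcal{G}(\emptyset)=0$ and $\mathcal{G}(G)=\mathrm{mex}\{\mathcal{G}(G\setminus N_G[v]) : v\in V(G)\}$, with $\mathrm{mex}(S)$ the least nonnegative integer not in $S$. -}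

module Defs where

open import Data.Bool using (Bool; true; false; not; _∧_; _∨_; if_then_else_)
open import Data.Nat using (ℕ; zero; suc; _≡ᵇ_)
open import Data.List using (List; []; _∷_; length; map; filter; concatMap; upTo)
open import Data.Bool.ListAction using (any)
open import Relation.Nullary using (Dec; yes; no)
open import Relation.Nullary.Decidable using (⌊_⌋)
open import Relation.Binary.PropositionalEquality using (_≡_)
import Data.List.Properties as LP
import Data.Nat.Properties as NP

_∈ᵇ_ : ℕ → List ℕ → Bool
k ∈ᵇ xs = any (λ x → x ≡ᵇ k) xs

-- search from k, with fuel; fuel = length suffices when starting at 0
mexFrom : ℕ → ℕ → List ℕ → ℕ
mexFrom k zero    xs = k
mexFrom k (suc f) xs = if k ∈ᵇ xs then mexFrom (suc k) f xs else k

mex : List ℕ → ℕ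
mex xs = mexFrom 0 (length xs) xs

-- Node-Kayles on a finite simple graph given by a list of (distinct)
-- vertices of a type V with decidable equality and a boolean adjacency
-- relation (symmetric, irreflexive).  A position is the induced subgraph
-- on the remaining vertex list S.

module NodeKayles {V : Set} (_≟_ : (u v : V) → Dec (u ≡ v))
                  (adj : V → V → Bool) where

  inClosedNbhd : V → V → Bool
  inClosedNbhd v u = ⌊ u ≟ v ⌋ ∨ adj v u

  remove : V → List V → List V
  remove v S = filter (λ u → not (inClosedNbhd v u) Data.Bool.≟ true) S

  -- Grundy value with fuel; each move removes ≥ 1 vertex, so fuel
  -- = number of vertices gives the true Grundy value.
  grundyF : ℕ → List V → ℕ
  grundyF zero    S = 0
  grundyF (suc f) S = mex (map (λ v → grundyF f (remove v S)) S)

  grundy : List V → ℕ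
  grundy S = grundyF (length S) S

-- The tree T_{a_0,...,a_n}.  Vertices are paths from the root, i.e. lists
-- [x_0,...,x_{k-1}] with x_i < a_i, k ≤ n+1 (the root is []).

treeVerts : List ℕ → List (List ℕ)
treeVerts []       = [] ∷ []
treeVerts (a ∷ as) = [] ∷ concatMap (λ x → map (x ∷_) (treeVerts as)) (upTo a)

-- isChild u v : v is a child of u, i.e. v = u ++ [x]
isChild : List ℕ → List ℕ → Bool
isChild []      (_ ∷ []) = true
isChild (x ∷ u) (y ∷ v)  = (x ≡ᵇ y) ∧ isChild u v
isChild _       _        = false

treeAdj : List ℕ → List ℕ → Bool
treeAdj u v = isChild u v ∨ isChild v u

grundyTree : List ℕ → ℕ
grundyTree as = NodeKayles.grundy (LP.≡-dec NP._≟_) treeAdj (treeVerts as)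

{-# OPTIONS --safe #-}
-- The first player wins by moving to a symmetric position.  Call σ a mirror
-- of a position if it is an involutive graph automorphism of it with u and
-- σ u distinct and non-adjacent for every vertex u.  In a position with a
-- mirror every move v can be answered by σ v, which leaves a position with
-- the same mirror, so by induction its Grundy value is 0.  If a₀ is even the
-- first player takes the root and the mirror swaps the root's branches
-- 2k ↔ 2k+1.  If a₀ is odd and a₁ is even he takes the root's first child
-- instead; the mirror then swaps the remaining a₀ - 1 branches of the root in
-- pairs and, below the removed child, the a₁ groups of surviving subtrees.
module Submission where

open import Defs
open import Data.Bool using (Bool; true; false; not; _∧_; _∨_; T)
open import Data.Bool.Properties using (not-injective)
open import Data.Empty using (⊥-elim)
open import Data.List using (List; []; _∷_; length; map; upTo)
open import Data.List.Properties using (≡-dec; ∷-injective; filter-notAll)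
open import Data.List.Membership.Propositional using (_∈_; _∉_; find; lose)
open import Data.List.Membership.Propositional.Properties
  using (∈-map⁺; ∈-map⁻; ∈-filter⁺; ∈-filter⁻; ∈-concatMap⁺; ∈-concatMap⁻; ∈-upTo⁺; ∈-upTo⁻)
open import Data.List.Relation.Binary.Prefix.Heterogeneous using (Prefix; []; _∷_)
open import Data.List.Relation.Unary.Any using (here; there)
import Data.List.Relation.Unary.Any as Any
open import Data.List.Relation.Unary.Any.Properties using (any⁺; any⁻)
open import Data.Nat using (ℕ; zero; suc; _≡ᵇ_; _<_; _≤_; _*_; z≤n; s≤s; z<s)
open import Data.Nat.Divisibility using (_∣_; divides)
import Data.Nat.Properties as ℕ
open import Data.Product using (∃-syntax; _×_; _,_)
import Data.Product as Product
open import Data.Sum using (_⊎_; inj₁; inj₂)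
open import Data.Unit using (tt)
open import Data.Vec using (Vec; _∷_; toList)
open import Data.Vec.Relation.Unary.All using (All)
open import Function using (_∘_; _⇔_; mk⇔)
open import Relation.Binary.Definitions using (DecidableEquality)
open import Relation.Binary.PropositionalEquality
open ≡-Reasoning
open import Relation.Nullary using (Dec)
open import Relation.Nullary.Decidable using (⌊_⌋; does-⇔; dec-true; dec-false; isYes≗does)

involution-≡⇔ : {A : Set} {f : A → A} → (∀ x → f (f x) ≡ x) → ∀ {x y} → f x ≡ f y ⇔ x ≡ y
involution-≡⇔ {f = f} f-involutive {x} {y} =
  mk⇔ (λ fx≡fy → trans (sym (f-involutive x)) (trans (cong f fx≡fy) (f-involutive y))) (cong f)

⌊⌋-⇔ : {A B : Set} → A ⇔ B → (a? : Dec A) (b? : Dec B) → ⌊ a? ⌋ ≡ ⌊ b? ⌋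
⌊⌋-⇔ A⇔B a? b? = trans (isYes≗does a?) (trans (does-⇔ A⇔B a? b?) (sym (isYes≗does b?)))

∈ᵇ⁺ : ∀ {k xs} → k ∈ xs → T (k ∈ᵇ xs)
∈ᵇ⁺ {k} = any⁺ (_≡ᵇ k) ∘ Any.map λ { refl → ℕ.≡⇒≡ᵇ k k refl }

∈ᵇ⁻ : ∀ {k} xs → T (k ∈ᵇ xs) → k ∈ xs
∈ᵇ⁻ {k} xs = Any.map (sym ∘ ℕ.≡ᵇ⇒≡ _ k) ∘ any⁻ (_≡ᵇ k) xs

k≤mexFrom : ∀ k f xs → k ≤ mexFrom k f xs
k≤mexFrom k zero    xs = ℕ.≤-refl
k≤mexFrom k (suc f) xs with k ∈ᵇ xs
... | true  = ℕ.≤-trans (ℕ.n≤1+n k) (k≤mexFrom (suc k) f xs)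
... | false = ℕ.≤-refl

0∈⇒0<mex : ∀ {xs} → 0 ∈ xs → 0 < mex xs
0∈⇒0<mex {x ∷ xs} 0∈xs with 0 ∈ᵇ (x ∷ xs) | ∈ᵇ⁺ 0∈xs
... | true  | _  = k≤mexFrom 1 (length xs) (x ∷ xs)
... | false | ()

0∉⇒mex≡0 : ∀ {xs} → 0 ∉ xs → mex xs ≡ 0
0∉⇒mex≡0 {[]}     _     = refl
0∉⇒mex≡0 {x ∷ xs} 0∉xs with 0 ∈ᵇ (x ∷ xs) in eq
... | true  = ⊥-elim (0∉xs (∈ᵇ⁻ (x ∷ xs) (subst T (sym eq) tt)))
... | false = refl

module NodeKaylesProperties {V : Set} (_≟_ : DecidableEquality V) (adj : V → V → Bool) where

  open NodeKayles _≟_ adj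

  survives? : (v u : V) → Dec (not (inClosedNbhd v u) ≡ true)
  survives? v u = not (inClosedNbhd v u) Data.Bool.≟ true

  inClosedNbhd-refl : ∀ v → inClosedNbhd v v ≡ true
  inClosedNbhd-refl v = cong (_∨ adj v v) (trans (isYes≗does (v ≟ v)) (dec-true (v ≟ v) refl))

  ∈-remove⁻ : ∀ {u v S} → u ∈ remove v S → u ∈ S × inClosedNbhd v u ≡ false
  ∈-remove⁻ {v = v} = Product.map₂ not-injective ∘ ∈-filter⁻ (survives? v)

  ∈-remove⁺ : ∀ {u v S} → u ∈ S → inClosedNbhd v u ≡ false → u ∈ remove v S
  ∈-remove⁺ {v = v} u∈S vu≡false = ∈-filter⁺ (survives? v) u∈S (cong not vu≡false)

  length-remove< : ∀ {v S} → v ∈ S → length (remove v S) < length S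
  length-remove< {v} {S} v∈S =
    filter-notAll (survives? v) S
      (Any.map (λ { refl → subst (λ b → not b ≢ true) (sym (inClosedNbhd-refl v)) λ () }) v∈S)

  0<grundyF-suc : ∀ {f w S} → w ∈ S → grundyF f (remove w S) ≡ 0 → 0 < grundyF (suc f) S
  0<grundyF-suc {f} {w} {S} w∈S w-wins =
    0∈⇒0<mex (subst (_∈ map (λ v → grundyF f (remove v S)) S) w-wins (∈-map⁺ _ w∈S))

  grundyF-suc≡0 : ∀ {f S} → (∀ {v} → v ∈ S → 0 < grundyF f (remove v S)) → grundyF (suc f) S ≡ 0
  grundyF-suc≡0 {f} {S} all-lose = 0∉⇒mex≡0 λ 0∈ →
    let v , v∈S , 0≡g = ∈-map⁻ (λ v → grundyF f (remove v S)) 0∈ in ℕ.<-irrefl 0≡g (all-lose v∈S)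

  module Mirror (σ : V → V) (σ-involutive : ∀ v → σ (σ v) ≡ v)
                (adj-σ : ∀ u v → adj (σ u) (σ v) ≡ adj u v) where

    inClosedNbhd-σ : ∀ u v → inClosedNbhd (σ u) (σ v) ≡ inClosedNbhd u v
    inClosedNbhd-σ u v =
      cong₂ _∨_ (⌊⌋-⇔ (involution-≡⇔ σ-involutive) (σ v ≟ σ u) (v ≟ u)) (adj-σ u v)

    Closed : List V → Set
    Closed S = ∀ {u} → u ∈ S → σ u ∈ S

    record Mirrored (P : List V) : Set where
      field
        closed : Closed P
        apart  : ∀ {u} → u ∈ P → inClosedNbhd u (σ u) ≡ false

    open Mirrored

    remove-closed : ∀ {w S} → σ w ≡ w → Closed S → Closed (remove w S)
    remove-closed {w} σw≡w S-closed {u} u∈ with u∈S , wu≡false ← ∈-remove⁻ u∈ =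
      ∈-remove⁺ (S-closed u∈S) (begin
        inClosedNbhd w (σ u)      ≡⟨ cong (λ x → inClosedNbhd x (σ u)) σw≡w ⟨
        inClosedNbhd (σ w) (σ u)  ≡⟨ inClosedNbhd-σ w u ⟩
        inClosedNbhd w u          ≡⟨ wu≡false ⟩
        false                     ∎)

    remove-pair-mirrored : ∀ {v P} → Mirrored P → v ∈ P → Mirrored (remove (σ v) (remove v P))
    remove-pair-mirrored {v} m v∈P .closed {u} u∈
      with u∈P₁ , σv-u ← ∈-remove⁻ u∈
      with u∈P , v-u ← ∈-remove⁻ u∈P₁ =
      ∈-remove⁺ (∈-remove⁺ (m .closed u∈P) v-σu) (trans (inClosedNbhd-σ v u) v-u)
      where
      v-σu : inClosedNbhd v (σ u) ≡ false
      v-σu = begin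
        inClosedNbhd v (σ u)          ≡⟨ cong (λ x → inClosedNbhd x (σ u)) (σ-involutive v) ⟨
        inClosedNbhd (σ (σ v)) (σ u)  ≡⟨ inClosedNbhd-σ (σ v) u ⟩
        inClosedNbhd (σ v) u          ≡⟨ σv-u ⟩
        false                         ∎
    remove-pair-mirrored m v∈P .apart u∈ =
      m .apart (Product.proj₁ (∈-remove⁻ (Product.proj₁ (∈-remove⁻ u∈))))

    mutual
      mirrored⇒grundyF≡0 : ∀ f {P} → Mirrored P → length P ≤ f → grundyF f P ≡ 0
      mirrored⇒grundyF≡0 zero    _ _ = refl
      mirrored⇒grundyF≡0 (suc f) m |P|≤1+f = grundyF-suc≡0 {f} λ v∈P →
        mirrorMove⇒0<grundyF f (∈-remove⁺ (m .closed v∈P) (m .apart v∈P))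
          (remove-pair-mirrored m v∈P) (ℕ.≤-pred (ℕ.≤-trans (length-remove< v∈P) |P|≤1+f))

      mirrorMove⇒0<grundyF : ∀ f {S w} → w ∈ S → Mirrored (remove w S) → length S ≤ f →
                             0 < grundyF f S
      mirrorMove⇒0<grundyF zero    {_ ∷ _} _ _ ()
      mirrorMove⇒0<grundyF (suc f) w∈S m |S|≤1+f =
        0<grundyF-suc {f} w∈S
          (mirrored⇒grundyF≡0 f m (ℕ.≤-pred (ℕ.≤-trans (length-remove< w∈S) |S|≤1+f)))

    fixedMove⇒0<grundy : ∀ {w S} → w ∈ S → σ w ≡ w → Closed S →
                         (∀ u → inClosedNbhd w u ≡ false → inClosedNbhd u (σ u) ≡ false) →
                         0 < grundy S
    fixedMove⇒0<grundy {S = S} w∈S σw≡w S-closed apart-off-N[w] =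
      mirrorMove⇒0<grundyF (length S) w∈S
        (record { closed = remove-closed σw≡w S-closed
                ; apart  = λ {u} u∈ → apart-off-N[w] u (Product.proj₂ (∈-remove⁻ {S = S} u∈)) })
        ℕ.≤-refl

∈-treeVerts⁺ : ∀ {u} as → Prefix _<_ u as → u ∈ treeVerts as
∈-treeVerts⁺ []       []            = here refl
∈-treeVerts⁺ (a ∷ as) []            = here refl
∈-treeVerts⁺ (a ∷ as) (x<a ∷ u≼as) =
  there (∈-concatMap⁺ (λ y → map (y ∷_) (treeVerts as))
          (lose (∈-upTo⁺ x<a) (∈-map⁺ (_ ∷_) (∈-treeVerts⁺ as u≼as))))

∈-treeVerts⁻ : ∀ {u} as → u ∈ treeVerts as → Prefix _<_ u as
∈-treeVerts⁻ {[]}    _        _ = []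
∈-treeVerts⁻ {x ∷ u} [] (there ())
∈-treeVerts⁻ {x ∷ u} (a ∷ as) (there x∷u∈)
  with y , y∈upTo , x∷u∈ ← find (∈-concatMap⁻ (λ y → map (y ∷_) (treeVerts as)) {xs = upTo a} x∷u∈)
  with w , w∈ , refl ← ∈-map⁻ (y ∷_) x∷u∈ = ∈-upTo⁻ y∈upTo ∷ ∈-treeVerts⁻ as w∈

partner : ℕ → ℕ
partner zero          = 1
partner (suc zero)    = 0
partner (suc (suc x)) = suc (suc (partner x))

partner-involutive : ∀ x → partner (partner x) ≡ x
partner-involutive zero          = refl
partner-involutive (suc zero)    = refl
partner-involutive (suc (suc x)) = cong (suc ∘ suc) (partner-involutive x)

partner-≢ : ∀ x → x ≢ partner x
partner-≢ (suc (suc x)) eq = partner-≢ x (ℕ.suc-injective (ℕ.suc-injective eq))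

partner-< : ∀ q {x} → x < q * 2 → partner x < q * 2
partner-< (suc q) {zero}          _                 = s≤s (s≤s z≤n)
partner-< (suc q) {suc zero}      _                 = z<s
partner-< (suc q) {suc (suc x)}   (s≤s (s≤s x<2q)) = s≤s (s≤s (partner-< q x<2q))

≡ᵇ-partner : ∀ x y → (partner x ≡ᵇ partner y) ≡ (x ≡ᵇ y)
≡ᵇ-partner x y = does-⇔ (involution-≡⇔ partner-involutive) (partner x ℕ.≟ partner y) (x ℕ.≟ y)

_≟ᴸ_ : DecidableEquality (List ℕ)
_≟ᴸ_ = ≡-dec ℕ._≟_

open NodeKayles _≟ᴸ_ treeAdj using (inClosedNbhd; remove)
open NodeKaylesProperties _≟ᴸ_ treeAdj using (module Mirror)

inClosedNbhd-∷ : ∀ z u v → inClosedNbhd (z ∷ u) (z ∷ v) ≡ inClosedNbhd u v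
inClosedNbhd-∷ z u v =
  cong₂ _∨_ (⌊⌋-⇔ ∷-≡⇔ ((z ∷ v) ≟ᴸ (z ∷ u)) (v ≟ᴸ u))
            (cong₂ _∨_ (cong (_∧ isChild u v) z≡ᵇz) (cong (_∧ isChild v u) z≡ᵇz))
  where
  ∷-≡⇔ : z ∷ v ≡ z ∷ u ⇔ v ≡ u
  ∷-≡⇔ = mk⇔ (Product.proj₂ ∘ ∷-injective) (cong (z ∷_))
  z≡ᵇz : (z ≡ᵇ z) ≡ true
  z≡ᵇz = dec-true (z ℕ.≟ z) refl

inClosedNbhd-head≢ : ∀ {x y} u v → x ≢ y → inClosedNbhd (x ∷ u) (y ∷ v) ≡ false
inClosedNbhd-head≢ {x} {y} u v x≢y =
  cong₂ _∨_ ≟-false (cong₂ _∨_ (cong (_∧ isChild u v) x≢ᵇy) (cong (_∧ isChild v u) y≢ᵇx))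
  where
  x≢ᵇy : (x ≡ᵇ y) ≡ false
  x≢ᵇy = dec-false (x ℕ.≟ y) x≢y
  y≢ᵇx : (y ≡ᵇ x) ≡ false
  y≢ᵇx = dec-false (y ℕ.≟ x) (x≢y ∘ sym)
  ≟-false : ⌊ (y ∷ v) ≟ᴸ (x ∷ u) ⌋ ≡ false
  ≟-false = trans (isYes≗does ((y ∷ v) ≟ᴸ (x ∷ u)))
                  (dec-false ((y ∷ v) ≟ᴸ (x ∷ u)) (x≢y ∘ sym ∘ Product.proj₁ ∘ ∷-injective))

mirrorAtRoot : List ℕ → List ℕ
mirrorAtRoot []      = []
mirrorAtRoot (x ∷ u) = partner x ∷ u

mirrorAtRoot-involutive : ∀ u → mirrorAtRoot (mirrorAtRoot u) ≡ u
mirrorAtRoot-involutive []      = refl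
mirrorAtRoot-involutive (x ∷ u) = cong (_∷ u) (partner-involutive x)

isChild-mirrorAtRoot : ∀ u v → isChild (mirrorAtRoot u) (mirrorAtRoot v) ≡ isChild u v
isChild-mirrorAtRoot []      []          = refl
isChild-mirrorAtRoot []      (y ∷ [])    = refl
isChild-mirrorAtRoot []      (y ∷ _ ∷ _) = refl
isChild-mirrorAtRoot (x ∷ u) []          = refl
isChild-mirrorAtRoot (x ∷ u) (y ∷ v)     = cong (_∧ isChild u v) (≡ᵇ-partner x y)

treeAdj-mirrorAtRoot : ∀ u v → treeAdj (mirrorAtRoot u) (mirrorAtRoot v) ≡ treeAdj u v
treeAdj-mirrorAtRoot u v = cong₂ _∨_ (isChild-mirrorAtRoot u v) (isChild-mirrorAtRoot v u)

prefix-mirrorAtRoot : ∀ q {as u} → Prefix _<_ u (q * 2 ∷ as) → Prefix _<_ (mirrorAtRoot u) (q * 2 ∷ as)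
prefix-mirrorAtRoot q []            = []
prefix-mirrorAtRoot q (x<2q ∷ u≼as) = partner-< q x<2q ∷ u≼as

apart-mirrorAtRoot : ∀ u → inClosedNbhd [] u ≡ false → inClosedNbhd u (mirrorAtRoot u) ≡ false
apart-mirrorAtRoot []      ()
apart-mirrorAtRoot (x ∷ u) _ = inClosedNbhd-head≢ u u (partner-≢ x)

mirrorAtFirstChild : List ℕ → List ℕ
mirrorAtFirstChild []          = []
mirrorAtFirstChild (zero ∷ u)  = zero ∷ mirrorAtRoot u
mirrorAtFirstChild (suc x ∷ u) = suc (partner x) ∷ u

mirrorAtFirstChild-involutive : ∀ u → mirrorAtFirstChild (mirrorAtFirstChild u) ≡ u
mirrorAtFirstChild-involutive []          = refl
mirrorAtFirstChild-involutive (zero ∷ u)  = cong (zero ∷_) (mirrorAtRoot-involutive u)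
mirrorAtFirstChild-involutive (suc x ∷ u) = cong (λ y → suc y ∷ u) (partner-involutive x)

isChild-mirrorAtFirstChild : ∀ u v → isChild (mirrorAtFirstChild u) (mirrorAtFirstChild v) ≡ isChild u v
isChild-mirrorAtFirstChild []          []              = refl
isChild-mirrorAtFirstChild []          (zero ∷ [])     = refl
isChild-mirrorAtFirstChild []          (suc y ∷ [])    = refl
isChild-mirrorAtFirstChild []          (zero ∷ _ ∷ _)  = refl
isChild-mirrorAtFirstChild []          (suc y ∷ _ ∷ _) = refl
isChild-mirrorAtFirstChild (zero ∷ u)  []              = refl
isChild-mirrorAtFirstChild (suc x ∷ u) []              = refl
isChild-mirrorAtFirstChild (zero ∷ u)  (zero ∷ v)      = isChild-mirrorAtRoot u v
isChild-mirrorAtFirstChild (zero ∷ u)  (suc y ∷ v)     = refl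
isChild-mirrorAtFirstChild (suc x ∷ u) (zero ∷ v)      = refl
isChild-mirrorAtFirstChild (suc x ∷ u) (suc y ∷ v)     = cong (_∧ isChild u v) (≡ᵇ-partner x y)

treeAdj-mirrorAtFirstChild : ∀ u v → treeAdj (mirrorAtFirstChild u) (mirrorAtFirstChild v) ≡ treeAdj u v
treeAdj-mirrorAtFirstChild u v = cong₂ _∨_ (isChild-mirrorAtFirstChild u v) (isChild-mirrorAtFirstChild v u)

prefix-mirrorAtFirstChild : ∀ q p {as u} → Prefix _<_ u (suc (q * 2) ∷ p * 2 ∷ as) →
                            Prefix _<_ (mirrorAtFirstChild u) (suc (q * 2) ∷ p * 2 ∷ as)
prefix-mirrorAtFirstChild q p []                                = []
prefix-mirrorAtFirstChild q p {u = zero ∷ _}  (0<1+2q ∷ u≼as)    = 0<1+2q ∷ prefix-mirrorAtRoot p u≼as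
prefix-mirrorAtFirstChild q p {u = suc _ ∷ _} (s≤s x<2q ∷ u≼as)  = s≤s (partner-< q x<2q) ∷ u≼as

apart-mirrorAtFirstChild : ∀ u → inClosedNbhd (zero ∷ []) u ≡ false →
                           inClosedNbhd u (mirrorAtFirstChild u) ≡ false
apart-mirrorAtFirstChild []                 ()
apart-mirrorAtFirstChild (zero ∷ [])        ()
apart-mirrorAtFirstChild (zero ∷ y ∷ [])    ()
apart-mirrorAtFirstChild (zero ∷ y ∷ z ∷ u) _ =
  trans (inClosedNbhd-∷ zero (y ∷ z ∷ u) (partner y ∷ z ∷ u))
        (inClosedNbhd-head≢ (z ∷ u) (z ∷ u) (partner-≢ y))
apart-mirrorAtFirstChild (suc x ∷ u)        _ = inClosedNbhd-head≢ u u (partner-≢ x ∘ ℕ.suc-injective)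

0<grundyTree-even : ∀ q as → 0 < grundyTree (q * 2 ∷ as)
0<grundyTree-even q as =
  fixedMove⇒0<grundy (here refl) refl
    (λ u∈ → ∈-treeVerts⁺ (q * 2 ∷ as) (prefix-mirrorAtRoot q (∈-treeVerts⁻ (q * 2 ∷ as) u∈)))
    apart-mirrorAtRoot
  where open Mirror mirrorAtRoot mirrorAtRoot-involutive treeAdj-mirrorAtRoot

0<grundyTree-odd-even : ∀ q p as → 0 < grundyTree (suc (q * 2) ∷ p * 2 ∷ as)
0<grundyTree-odd-even q p as =
  fixedMove⇒0<grundy (∈-treeVerts⁺ as′ (z<s ∷ [])) refl
    (λ u∈ → ∈-treeVerts⁺ as′ (prefix-mirrorAtFirstChild q p (∈-treeVerts⁻ as′ u∈)))
    apart-mirrorAtFirstChild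
  where
  open Mirror mirrorAtFirstChild mirrorAtFirstChild-involutive treeAdj-mirrorAtFirstChild
  as′ : List ℕ
  as′ = suc (q * 2) ∷ p * 2 ∷ as

even-or-odd : ∀ n → ∃[ q ] (n ≡ q * 2 ⊎ n ≡ suc (q * 2))
even-or-odd zero = 0 , inj₁ refl
even-or-odd (suc n) with even-or-odd n
... | q , inj₁ n≡2q   = q , inj₂ (cong suc n≡2q)
... | q , inj₂ n≡2q+1 = suc q , inj₁ (cong suc n≡2q+1)

-- The mirror argument does not need the hypothesis 1 ≤ aᵢ.
mainTheorem3 : (m : ℕ) (a₀ a₁ : ℕ) (rest : Vec ℕ m) →
    All (λ x → 1 ≤ x) (a₀ ∷ a₁ ∷ rest) →
    (2 ∣ a₀ ⊎ 2 ∣ a₁) →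
    0 < grundyTree (toList (a₀ ∷ a₁ ∷ rest))
mainTheorem3 m a₀ a₁ rest _ (inj₁ (divides q refl)) = 0<grundyTree-even q (a₁ ∷ toList rest)
mainTheorem3 m a₀ a₁ rest _ (inj₂ (divides p refl)) with even-or-odd a₀
... | q , inj₁ refl = 0<grundyTree-even q (p * 2 ∷ toList rest)
... | q , inj₂ refl = 0<grundyTree-odd-even q p (toList rest)
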